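{- Let $n>2$ be an integer and $1\le s\le\lfloor (n-1)/2\rfloor$. Then $$K_n(s)=T_{n+1}(s)+T_{n-1}(s-1)+2T_{n-2}(s-1).$$
   Context: Binomial coefficients satisfy $\binom{m}{k}=0$ for $k>m$. For $n\ge1$ and $0\le s\le\lfloor (n-1)/2\rfloor$, the incomplete Tribonacci numbers are $T_n(s)=\sum_{i=0}^{s}\sum_{j=0}^{i}\binom{i}{j}\binom{n-i-j-1}{i}$. For $n\ge1$ and $0\le s\le\lfloor n/2\rfloor$, the incomplete Tribonacci-Lucas numbers are $$K_n(s)=\sum_{i=0}^{s}\ \sum_{\substack{0\le j\le i\\ i+j<n}}\frac{n}{n-i-j}\binom{i}{j}\binom{n-i-j}{i}.$$ -}

module Defs where

open import Data.Nat using (ℕ; zero; suc; _+_; _*_; _∸_; _<?_; >-nonZero)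
open import Data.Nat.Properties using (m<n⇒0<n∸m)
open import Data.Nat.Combinatorics using (_C_)
open import Relation.Nullary using (yes; no)
open import Data.Integer using (+_)
open import Data.Rational using (ℚ; 0ℚ; _/_) renaming (_+_ to _+ℚ_; _*_ to _*ℚ_)

sumTo : ℕ → (ℕ → ℕ) → ℕ
sumTo zero    f = f 0
sumTo (suc s) f = sumTo s f + f (suc s)

sumToℚ : ℕ → (ℕ → ℚ) → ℚ
sumToℚ zero    f = f 0
sumToℚ (suc s) f = sumToℚ s f +ℚ f (suc s)

-- incomplete Tribonacci numbers  T_n(s) = Σ_{i=0}^s Σ_{j=0}^i C(i,j) C(n-i-j-1,i)
-- (C is the stdlib binomial, with m C k = 0 for k > m; in the paper's range
--  n - i - j - 1 never goes negative below what matters, since C(m,i)=0 for m<i)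
T : ℕ → ℕ → ℕ
T n s = sumTo s (λ i → sumTo i (λ j → (i C j) * ((n ∸ i ∸ j ∸ 1) C i)))

-- summand of K_n(s): n/(n-i-j) * C(i,j) * C(n-i-j,i) if i + j < n, else 0 (term absent)
Kterm : ℕ → ℕ → ℕ → ℚ
Kterm n i j with i + j <? n
... | yes p = ((+ n) / (n ∸ (i + j))) {{>-nonZero (m<n⇒0<n∸m p)}}
                *ℚ ((+ ((i C j) * ((n ∸ (i + j)) C i))) / 1)
... | no _  = 0ℚ

K : ℕ → ℕ → ℚ
K n s = sumToℚ s (λ i → sumToℚ i (λ j → Kterm n i j))

module Submission where

-- Proof idea.  Write a summand of K_n(s) with i + j < n as n = i + j + m + 1.
-- The corollary holds summand by summand:
--
--   n/(m+1) C(i,j) C(m+1,i)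
--     = C(i,j) C(m+1,i) + [i ≥ 1] C(m,i-1) (C(i-1,j) + 2 [j ≥ 1] C(i-1,j-1)).
--
-- Clearing the denominator and cancelling (m+1) C(i,j) C(m+1,i), this is
-- (i + j) C(i,j) C(m+1,i) = (m+1) [i ≥ 1] C(m,i-1) (...), which follows from absorption, i C(m+1,i) = (m+1) C(m,i-1), and the weight
-- identity (i + j) C(i,j) = i (C(i-1,j) + 2 C(i-1,j-1)).  The three terms on
-- the right are the (i,j)-summand of T_{n+1} and the summands of T_{n-1} at
-- (i-1,j) and of T_{n-2} at (i-1,j-1).  So every summand of K_n(s) is a natural
-- number, and summing, the shifts by one in i (and j) produce T_{n-1}(s-1) and
-- T_{n-2}(s-1).

open import Defs
open import Data.Nat using (ℕ; _+_; _*_; _∸_; _≤_; _<_) renaming (_/_ to _div_)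
open import Data.Integer using (+_)
open import Data.Rational using (_/_)
open import Relation.Binary.PropositionalEquality using (_≡_)

open import Data.Nat using (zero; suc; NonZero; >-nonZero; z≤n; s≤s; _<?_)
open import Data.Nat.Properties
open import Data.Nat.DivMod using (m/n*n≤m)
open import Data.Nat.Combinatorics using (_C_; nC1≡n; nCk+nC[k+1]≡[n+1]C[k+1]; k>n⇒nCk≡0)
open import Data.Nat.Tactic.RingSolver using (solve; solve-∀)
open import Algebra.Properties.CommutativeSemigroup +-commutativeSemigroup
  using () renaming (interchange to +-interchange)
open import Data.List using (_∷_; [])
open import Data.Product using (_,_)
open import Data.Empty using (⊥-elim-irr)
open import Relation.Nullary using (yes; no; contradiction)
open import Relation.Binary.PropositionalEquality
  using (refl; sym; trans; cong; cong₂; module ≡-Reasoning)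
import Data.Integer as ℤ
import Data.Integer.Properties as ℤ
open import Data.Rational using (ℚ; toℚᵘ) renaming (_+_ to _+ℚ_; _*_ to _*ℚ_)
open import Data.Rational.Properties
  using (toℚᵘ-injective; toℚᵘ-fromℚᵘ; toℚᵘ-homo-*; toℚᵘ-homo-+)
open import Data.Rational.Unnormalised using (mkℚᵘ; *≡*)
import Data.Rational.Unnormalised.Properties as ℚᵘ

pascal : ∀ n k → suc n C suc k ≡ n C k + n C suc k
pascal n k = sym (nCk+nC[k+1]≡[n+1]C[k+1] n k)

-- Absorption: (k+1) C(n+1,k+1) = (n+1) C(n,k).  It moves the factor i
-- of the weight identity onto the "m" binomial coefficient.
absorption : ∀ n k → suc k * (suc n C suc k) ≡ suc n * (n C k)
absorption n       zero    = trans (+-identityʳ _) (trans (nC1≡n (suc n)) (sym (*-identityʳ (suc n))))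
absorption zero    (suc k) = *-zeroʳ (suc (suc k))
absorption (suc n) (suc k) = begin
  suc (suc k) * (suc (suc n) C suc (suc k))      ≡⟨ cong (suc (suc k) *_) (pascal (suc n) (suc k)) ⟩
  suc (suc k) * (A + B)                          ≡⟨ *-distribˡ-+ (suc (suc k)) A B ⟩
  A + suc k * A + suc (suc k) * B                ≡⟨ +-assoc A _ _ ⟩
  A + (suc k * A + suc (suc k) * B)              ≡⟨ cong₂ (λ u v → A + (u + v)) (absorption n k) (absorption n (suc k)) ⟩
  A + (suc n * (n C k) + suc n * (n C suc k))    ≡⟨ cong (λ u → A + u) (*-distribˡ-+ (suc n) (n C k) (n C suc k)) ⟨
  A + suc n * (n C k + n C suc k)                ≡⟨ cong (λ u → A + suc n * u) (pascal n k) ⟨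
  suc (suc n) * A                                ∎
  where
  open ≡-Reasoning
  A = suc n C suc k
  B = suc n C suc (suc k)

prev : (ℕ → ℕ) → ℕ → ℕ
prev f zero    = 0
prev f (suc k) = f k

weight : ℕ → ℕ → ℕ
weight i j = i C j + 2 * prev (i C_) j

weight-identity : ∀ i j → (suc i + j) * (suc i C j) ≡ suc i * weight i j
weight-identity i zero    = cong (_* 1) (+-identityʳ (suc i))
  -- both binomial coefficients C(i+1,0) and C(i,0) compute to 1
weight-identity i (suc j) = begin
  (suc i + suc j) * X                           ≡⟨ *-distribʳ-+ X (suc i) (suc j) ⟩
  suc i * X + suc j * X                         ≡⟨ cong₂ _+_ (cong (suc i *_) (pascal i j)) (absorption i j) ⟩
  suc i * (i C j + i C suc j) + suc i * (i C j) ≡⟨ collect (suc i) (i C j) (i C suc j) ⟩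
  suc i * (i C suc j + 2 * (i C j))             ∎
  where
  open ≡-Reasoning
  X = suc i C suc j
  collect : ∀ a x y → a * (x + y) + a * x ≡ a * (y + 2 * x)
  collect = solve-∀

trib : ℕ → ℕ → ℕ → ℕ
trib N i j = (i C j) * ((N ∸ i ∸ j ∸ 1) C i)

correction : ℕ → ℕ → ℕ → ℕ
correction n i j = trib (n ∸ 1) i j + 2 * prev (trib (n ∸ 2) i) j

-- The integer value of the (i,j)-summand of K_n(s): the summand of T_{n+1}
-- plus the correction shifted by one in i.
lucasTerm : ℕ → ℕ → ℕ → ℕ
lucasTerm n i j = trib (n + 1) i j + prev (λ i′ → correction n i′ j) i

trib-at : ∀ N r i j → N ≡ r + (i + j + 1) → trib N i j ≡ (i C j) * (r C i)
trib-at N r i j N≡ = cong (λ x → (i C j) * (x C i)) (begin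
  N ∸ i ∸ j ∸ 1                       ≡⟨ cong (_∸ 1) (∸-+-assoc N i j) ⟩
  N ∸ (i + j) ∸ 1                     ≡⟨ ∸-+-assoc N (i + j) 1 ⟩
  N ∸ (i + j + 1)                     ≡⟨ cong (_∸ (i + j + 1)) N≡ ⟩
  r + (i + j + 1) ∸ (i + j + 1)       ≡⟨ m+n∸n≡m r (i + j + 1) ⟩
  r                                   ∎)
  where open ≡-Reasoning

correction-at : ∀ m i j → correction (suc (suc i + j + m)) i j ≡ weight i j * (m C i)
correction-at m i j = begin
  trib (suc (i + j + m)) i j + 2 * prev (trib (i + j + m) i) j
    ≡⟨ cong₂ (λ u v → u + 2 * v) (trib-at _ m i j (solve (i ∷ j ∷ m ∷ []))) (shifted j) ⟩
  (i C j) * (m C i) + 2 * (prev (i C_) j * (m C i))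
    ≡⟨ factor (i C j) (prev (i C_) j) (m C i) ⟩
  weight i j * (m C i) ∎
  where
  open ≡-Reasoning
  factor : ∀ x y c → x * c + 2 * (y * c) ≡ (x + 2 * y) * c
  factor = solve-∀
  shifted : ∀ j → prev (trib (i + j + m) i) j ≡ prev (i C_) j * (m C i)
  shifted zero     = refl
  shifted (suc j′) = trib-at _ m i j′ (solve (i ∷ j′ ∷ m ∷ []))

shifted-correction-at : ∀ m i j → let n = suc (i + j + m) in
  prev (λ i′ → correction n i′ j) i ≡ prev (λ i′ → weight i′ j * (m C i′)) i
shifted-correction-at m zero    j = refl
shifted-correction-at m (suc i) j = correction-at m i j

excess-identity : ∀ m i j →
  (i + j) * ((i C j) * (suc m C i)) ≡ suc m * prev (λ i′ → weight i′ j * (m C i′)) i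
excess-identity m zero    zero    = sym (*-zeroʳ (suc m))
excess-identity m zero    (suc j) = trans (*-zeroʳ (suc j)) (sym (*-zeroʳ (suc m)))
excess-identity m (suc i) j = begin
  (suc i + j) * ((suc i C j) * (suc m C suc i))   ≡⟨ *-assoc (suc i + j) (suc i C j) (suc m C suc i) ⟨
  ((suc i + j) * (suc i C j)) * (suc m C suc i)   ≡⟨ cong (_* (suc m C suc i)) (weight-identity i j) ⟩
  suc i * W * (suc m C suc i)                     ≡⟨ swap (suc i) W (suc m C suc i) ⟩
  W * (suc i * (suc m C suc i))                   ≡⟨ cong (W *_) (absorption m i) ⟩
  W * (suc m * (m C i))                           ≡⟨ exchange W (suc m) (m C i) ⟩
  suc m * (W * (m C i))                           ∎
  where
  open ≡-Reasoning
  W = weight i j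
  swap : ∀ a b c → a * b * c ≡ b * (a * c)
  swap = solve-∀
  exchange : ∀ a b c → a * (b * c) ≡ b * (a * c)
  exchange = solve-∀

lucasTerm-numerator : ∀ m i j → let n = suc (i + j + m) in
  n * ((i C j) * (suc m C i)) ≡ lucasTerm n i j * suc m
lucasTerm-numerator m i j = begin
  suc (i + j + m) * X             ≡⟨ split-factor i j m X ⟩
  suc m * X + (i + j) * X         ≡⟨ cong (λ u → suc m * X + u) (excess-identity m i j) ⟩
  suc m * X + suc m * P           ≡⟨ collect m X P ⟩
  (X + P) * suc m                 ≡⟨ cong (_* suc m) (cong₂ _+_ main-at (shifted-correction-at m i j)) ⟨
  lucasTerm (suc (i + j + m)) i j * suc m ∎
  where
  open ≡-Reasoning
  X = (i C j) * (suc m C i)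
  P = prev (λ i′ → weight i′ j * (m C i′)) i
  split-factor : ∀ i j m x → suc (i + j + m) * x ≡ suc m * x + (i + j) * x
  split-factor = solve-∀
  collect : ∀ m x p → suc m * x + suc m * p ≡ (x + p) * suc m
  collect = solve-∀
  main-at : trib (suc (i + j + m) + 1) i j ≡ X
  main-at = trib-at _ (suc m) i j (solve (i ∷ j ∷ m ∷ []))

toℚ : ℕ → ℚ
toℚ a = (+ a) / 1

toℚ-homo-+ : ∀ a b → toℚ a +ℚ toℚ b ≡ toℚ (a + b)
toℚ-homo-+ a b = toℚᵘ-injective (ℚᵘ.≃-trans (toℚᵘ-homo-+ (toℚ a) (toℚ b))
  (ℚᵘ.≃-trans (ℚᵘ.+-cong (toℚᵘ-fromℚᵘ (mkℚᵘ (+ a) 0)) (toℚᵘ-fromℚᵘ (mkℚᵘ (+ b) 0)))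
  (ℚᵘ.≃-trans (*≡* numerators) (ℚᵘ.≃-sym (toℚᵘ-fromℚᵘ (mkℚᵘ (+ (a + b)) 0))))))
  where
  numerators : (+ a ℤ.* + 1 ℤ.+ + b ℤ.* + 1) ℤ.* + 1 ≡ + (a + b) ℤ.* + 1
  numerators = cong (ℤ._* + 1) (trans
    (cong₂ ℤ._+_ (ℤ.*-identityʳ (+ a)) (ℤ.*-identityʳ (+ b))) (sym (ℤ.pos-+ a b)))

ratio-integral : ∀ a d c g .{{_ : NonZero d}} →
  a * c ≡ g * d → ((+ a) / d) *ℚ toℚ c ≡ toℚ g
ratio-integral a zero    c g {{d≢0}} _ = ⊥-elim-irr (NonZero.nonZero d≢0)
ratio-integral a (suc d) c g ac≡gd = toℚᵘ-injective
  (ℚᵘ.≃-trans (toℚᵘ-homo-* ((+ a) / suc d) (toℚ c))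
  (ℚᵘ.≃-trans (ℚᵘ.*-cong (toℚᵘ-fromℚᵘ (mkℚᵘ (+ a) d)) (toℚᵘ-fromℚᵘ (mkℚᵘ (+ c) 0)))
  (ℚᵘ.≃-trans (*≡* numerators) (ℚᵘ.≃-sym (toℚᵘ-fromℚᵘ (mkℚᵘ (+ g) 0))))))
  where
  open ≡-Reasoning
  numerators : (+ a ℤ.* + c) ℤ.* + 1 ≡ + g ℤ.* + suc (d * 1)
  numerators = begin
    (+ a ℤ.* + c) ℤ.* + 1   ≡⟨ ℤ.*-identityʳ _ ⟩
    + a ℤ.* + c             ≡⟨ ℤ.pos-* a c ⟨
    + (a * c)               ≡⟨ cong +_ (trans ac≡gd (cong (λ x → g * suc x) (sym (*-identityʳ d)))) ⟩
    + (g * suc (d * 1))     ≡⟨ ℤ.pos-* g (suc (d * 1)) ⟩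
    + g ℤ.* + suc (d * 1)   ∎

Kterm-integral : ∀ n i j → i + j < n → Kterm n i j ≡ toℚ (lucasTerm n i j)
Kterm-integral n i j i+j<n with i + j <? n
... | no i+j≮n = contradiction i+j<n i+j≮n
... | yes _ with m≤n⇒∃[o]m+o≡n i+j<n
... | m , refl = ratio-integral n (n ∸ (i + j)) ((i C j) * ((n ∸ (i + j)) C i)) (lucasTerm n i j)
                   {{>-nonZero (m<n⇒0<n∸m i+j<n)}} (begin
  n * ((i C j) * ((n ∸ (i + j)) C i))           ≡⟨ cong (λ d → n * ((i C j) * (d C i))) denominator ⟩
  n * ((i C j) * (suc m C i))                   ≡⟨ lucasTerm-numerator m i j ⟩
  lucasTerm n i j * suc m                       ≡⟨ cong (lucasTerm n i j *_) denominator ⟨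
  lucasTerm n i j * (n ∸ (i + j))               ∎)
  where
  open ≡-Reasoning
  denominator : suc (i + j + m) ∸ (i + j) ≡ suc m
  denominator = trans (cong (_∸ (i + j)) (sym (+-suc (i + j) m))) (m+n∸m≡n (i + j) (suc m))

sumTo-cong : ∀ s f g → (∀ k → f k ≡ g k) → sumTo s f ≡ sumTo s g
sumTo-cong zero    f g f≡g = f≡g 0
sumTo-cong (suc s) f g f≡g = cong₂ _+_ (sumTo-cong s f g f≡g) (f≡g (suc s))

sumTo-+ : ∀ s f g → sumTo s (λ k → f k + g k) ≡ sumTo s f + sumTo s g
sumTo-+ zero    f g = refl
sumTo-+ (suc s) f g = trans (cong (_+ (f (suc s) + g (suc s))) (sumTo-+ s f g))
  (+-interchange (sumTo s f) (sumTo s g) (f (suc s)) (g (suc s)))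

sumTo-* : ∀ s c f → sumTo s (λ k → c * f k) ≡ c * sumTo s f
sumTo-* zero    c f = refl
sumTo-* (suc s) c f = trans (cong (_+ c * f (suc s)) (sumTo-* s c f))
  (sym (*-distribˡ-+ c (sumTo s f) (f (suc s))))

sumTo-prev : ∀ s f → sumTo (suc s) (prev f) ≡ sumTo s f
sumTo-prev zero    f = refl
sumTo-prev (suc s) f = cong (_+ f (suc s)) (sumTo-prev s f)

sumToℚ-cong : ∀ s f g → (∀ k → k ≤ s → f k ≡ g k) → sumToℚ s f ≡ sumToℚ s g
sumToℚ-cong zero    f g f≡g = f≡g 0 z≤n
sumToℚ-cong (suc s) f g f≡g = cong₂ _+ℚ_
  (sumToℚ-cong s f g (λ k k≤s → f≡g k (m≤n⇒m≤1+n k≤s))) (f≡g (suc s) ≤-refl)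

sumToℚ-toℚ : ∀ s f → sumToℚ s (λ k → toℚ (f k)) ≡ toℚ (sumTo s f)
sumToℚ-toℚ zero    f = refl
sumToℚ-toℚ (suc s) f = trans (cong (_+ℚ toℚ (f (suc s))) (sumToℚ-toℚ s f))
  (toℚ-homo-+ (sumTo s f) (f (suc s)))

-- Row i+1 of the corrections sums to row i of T_{n-1} plus twice row i of
-- T_{n-2}: the last term of the first sum has C(i,i+1) = 0.
correction-row : ∀ n i →
  sumTo (suc i) (correction n i) ≡ sumTo i (trib (n ∸ 1) i) + 2 * sumTo i (trib (n ∸ 2) i)
correction-row n i = begin
  sumTo (suc i) (correction n i)
    ≡⟨ sumTo-+ (suc i) (trib (n ∸ 1) i) (λ j → 2 * prev (trib (n ∸ 2) i) j) ⟩
  sumTo (suc i) (trib (n ∸ 1) i) + sumTo (suc i) (λ j → 2 * prev (trib (n ∸ 2) i) j)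
    ≡⟨ cong₂ _+_ last-vanishes (trans (sumTo-* (suc i) 2 _) (cong (2 *_) (sumTo-prev i _))) ⟩
  sumTo i (trib (n ∸ 1) i) + 2 * sumTo i (trib (n ∸ 2) i) ∎
  where
  open ≡-Reasoning
  last-vanishes : sumTo (suc i) (trib (n ∸ 1) i) ≡ sumTo i (trib (n ∸ 1) i)
  last-vanishes = trans
    (cong (λ c → sumTo i (trib (n ∸ 1) i) + c * ((n ∸ 1 ∸ i ∸ suc i ∸ 1) C i)) (k>n⇒nCk≡0 (n<1+n i)))
    (+-identityʳ _)

lucasTerm-sum : ∀ n s →
  sumTo (suc s) (λ i → sumTo i (lucasTerm n i)) ≡ T (n + 1) (suc s) + T (n ∸ 1) s + 2 * T (n ∸ 2) s
lucasTerm-sum n s = begin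
  sumTo (suc s) (λ i → sumTo i (lucasTerm n i))
    ≡⟨ sumTo-cong (suc s) _ _ (λ i → sumTo-+ i (trib (n + 1) i) _) ⟩
  sumTo (suc s) (λ i → sumTo i (trib (n + 1) i) + sumTo i (λ j → prev (λ i′ → correction n i′ j) i))
    ≡⟨ sumTo-+ (suc s) _ _ ⟩
  T (n + 1) (suc s) + sumTo (suc s) (λ i → sumTo i (λ j → prev (λ i′ → correction n i′ j) i))
    ≡⟨ cong (λ u → T (n + 1) (suc s) + u) (trans (sumTo-cong (suc s) _ _ row-shift) (sumTo-prev s _)) ⟩
  T (n + 1) (suc s) + sumTo s (λ i → sumTo (suc i) (correction n i))
    ≡⟨ cong (λ u → T (n + 1) (suc s) + u) (sumTo-cong s _ _ (correction-row n)) ⟩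
  T (n + 1) (suc s) + sumTo s (λ i → sumTo i (trib (n ∸ 1) i) + 2 * sumTo i (trib (n ∸ 2) i))
    ≡⟨ cong (λ u → T (n + 1) (suc s) + u) (trans (sumTo-+ s _ _) (cong (λ u → T (n ∸ 1) s + u) (sumTo-* s 2 _))) ⟩
  T (n + 1) (suc s) + (T (n ∸ 1) s + 2 * T (n ∸ 2) s)
    ≡⟨ +-assoc (T (n + 1) (suc s)) (T (n ∸ 1) s) (2 * T (n ∸ 2) s) ⟨
  T (n + 1) (suc s) + T (n ∸ 1) s + 2 * T (n ∸ 2) s ∎
  where
  open ≡-Reasoning
  row-shift : ∀ i → sumTo i (λ j → prev (λ i′ → correction n i′ j) i)
                  ≡ prev (λ i′ → sumTo (suc i′) (correction n i′)) i
  row-shift zero    = refl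
  row-shift (suc i) = refl

-- In the range of the corollary all summands of K_n(s) are present.
summation-range : ∀ n s i j → 0 < n → s ≤ (n ∸ 1) div 2 → i ≤ s → j ≤ i → i + j < n
summation-range (suc n) s i j _ s≤ i≤s j≤i =
  s≤s (≤-trans (+-mono-≤ i≤s (≤-trans j≤i i≤s)) s+s≤n)
  where
  s+s≤n : s + s ≤ n
  s+s≤n = ≤-trans (≤-reflexive (solve (s ∷ []))) (≤-trans (*-monoˡ-≤ 2 s≤) (m/n*n≤m n 2))

corollary5 : ∀ (n s : ℕ) → 2 < n → 1 ≤ s → s ≤ (n ∸ 1) div 2 →
    K n s ≡ (+ (T (n + 1) s + T (n ∸ 1) (s ∸ 1) + 2 * T (n ∸ 2) (s ∸ 1))) / 1
corollary5 n (suc s) 2<n _ s≤ = begin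
  K n (suc s)
    ≡⟨ sumToℚ-cong (suc s) _ _ (λ i i≤s → sumToℚ-cong i _ _ (λ j j≤i →
         Kterm-integral n i j (summation-range n (suc s) i j 0<n s≤ i≤s j≤i))) ⟩
  sumToℚ (suc s) (λ i → sumToℚ i (λ j → toℚ (lucasTerm n i j)))
    ≡⟨ sumToℚ-cong (suc s) _ _ (λ i _ → sumToℚ-toℚ i (lucasTerm n i)) ⟩
  sumToℚ (suc s) (λ i → toℚ (sumTo i (lucasTerm n i)))
    ≡⟨ sumToℚ-toℚ (suc s) (λ i → sumTo i (lucasTerm n i)) ⟩
  toℚ (sumTo (suc s) (λ i → sumTo i (lucasTerm n i)))
    ≡⟨ cong toℚ (lucasTerm-sum n s) ⟩
  toℚ (T (n + 1) (suc s) + T (n ∸ 1) s + 2 * T (n ∸ 2) s) ∎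
  where
  open ≡-Reasoning
  0<n : 0 < n
  0<n = ≤-trans (s≤s z≤n) 2<n
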